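{- Let $t$ be a positive integer, let $B$ be a subgraph of $B_G$ (with sides $O$, $I$), and fix $v^*\in V$. Over $\mathrm{GF}(2^t)$, in variables $\{x_e\}_{e\in E(B)}$, define $R=\sum_{M}\prod_{e\in M}x_e$ over all connected perfect matchings $M$ of $B$; for $X\subseteq V$ define $P_X=\sum_{M\in\mathcal{PM}(B[X])}\prod_{e\in M}x_e$, where $B[X]$ is the subgraph of $B$ induced by $\{v^I_j, v^O_i : v\in X\}$ and $\mathcal{PM}(H)$ is the set of perfect matchings of $H$; and define $P=\sum_{X\subseteq V,\ v^*\in X}P_X P_{V\setminus X}$. Then $P=R$.
   Context: Let $G=(V,E)$ be a digraph and $\mathsf{in},\mathsf{out}:V\to\mathbb{Z}_{\ge 0}$. The bipartite graph $B_G$ has sides $O=\{v^O_i : v\in V,\ 1\le i\le\mathsf{out}(v)\}$ and $I=\{v^I_j : v\in V,\ 1\le j\le\mathsf{in}(v)\}$ and edges $\{u^O_iv^I_j : (u,v)\in E(G)\}$. A matching $M$ is connected if for every $X$ with $\emptyset\ne X\subsetneq V$, $M$ contains an edge $u^O_iv^I_j$ with exactly one of $u,v$ in $X$. The empty graph has exactly one (empty) perfect matching. -}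

module Defs where

open import Level using (_⊔_)
open import Algebra.Bundles using (CommutativeRing)
open import Data.Bool.Base using (Bool; true; false; _∧_; _∨_; not; if_then_else_)
open import Data.Nat.Base using (ℕ; zero; suc; _∸_; _≡ᵇ_)
import Data.Nat.Base as ℕ
open import Data.Fin.Base using (Fin; zero; suc; toℕ; splitAt; combine; remQuot)
import Data.Fin.Properties as FinP
open import Data.Vec.Functional using (head; tail) renaming (_∷_ to _∷ᶠ_)
open import Data.List.Base using (List; []; _∷_; map; _++_; foldr)
open import Data.Product.Base using (Σ; ∃; _×_; _,_; proj₁; proj₂)
open import Data.Sum.Base using (inj₁; inj₂)
open import Function.Base using (_∘_)
open import Relation.Nullary using (¬_)
open import Relation.Nullary.Decidable using (⌊_⌋)
open import Relation.Binary.PropositionalEquality using (_≡_)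

record IsField {c ℓ} (F : CommutativeRing c ℓ) : Set (c ⊔ ℓ) where
  open CommutativeRing F using (Carrier; _≈_; _+_; _*_; 0#; 1#)
  field
    0≉1     : ¬ (0# ≈ 1#)
    inverse : ∀ x → ¬ (x ≈ 0#) → ∃ λ y → (x * y) ≈ 1#

HasCard : ∀ {c ℓ} (F : CommutativeRing c ℓ) → ℕ → Set (c ⊔ ℓ)
HasCard F k = Σ (Fin k → Carrier) λ enum →
    (∀ i j → enum i ≈ enum j → i ≡ j) × (∀ x → ∃ λ i → enum i ≈ x)
  where open CommutativeRing F

sumℕ : ∀ n → (Fin n → ℕ) → ℕ
sumℕ zero    f = 0
sumℕ (suc n) f = f zero ℕ.+ sumℕ n (f ∘ suc)

allF : ∀ n → (Fin n → Bool) → Bool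
allF zero    p = true
allF (suc n) p = p zero ∧ allF n (p ∘ suc)

anyF : ∀ n → (Fin n → Bool) → Bool
anyF zero    p = false
anyF (suc n) p = p zero ∨ anyF n (p ∘ suc)

countF : ∀ n → (Fin n → Bool) → ℕ
countF n p = sumℕ n (λ i → if p i then 1 else 0)

allL : ∀ {a} {A : Set a} → List A → (A → Bool) → Bool
allL xs p = foldr (λ x b → p x ∧ b) true xs

_⇒ᵇ_ : Bool → Bool → Bool
a ⇒ᵇ b = not a ∨ b

subsets : ∀ k → List (Fin k → Bool)
subsets zero    = (λ ()) ∷ []
subsets (suc k) = map (false ∷ᶠ_) (subsets k) ++ map (true ∷ᶠ_) (subsets k)

-- Fin (f 0 + f 1 + ... + f (n-1)) is split into consecutive blocks of sizes f v;
-- ownerF sends an index to the v whose block it lies in.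
ownerF : ∀ n (f : Fin n → ℕ) → Fin (sumℕ n f) → Fin n
ownerF (suc n) f k with splitAt (f zero) k
... | inj₁ _  = zero
... | inj₂ k' = suc (ownerF n (f ∘ suc) k')

-- V = Fin n.
-- O = {v^O_i} is encoded as Fin NO (block of v has out(v) elements),
-- I = {v^I_j} is encoded as Fin NI (block of v has in(v) elements).
-- A pair (o , i) ∈ O × I is encoded as combine o i : Fin NE; edge sets of
-- subgraphs of B_G are subsets of Fin NE.

module BG (n : ℕ) (inD outD : Fin n → ℕ) where

  NO NI NE : ℕ
  NO = sumℕ n outD
  NI = sumℕ n inD
  NE = NO ℕ.* NI

  ownO : Fin NO → Fin n
  ownO = ownerF n outD

  ownI : Fin NI → Fin n
  ownI = ownerF n inD

  src : Fin NE → Fin NO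
  src e = proj₁ (remQuot {NO} NI e)

  tgt : Fin NE → Fin NI
  tgt e = proj₂ (remQuot {NO} NI e)

  degO : (Fin NE → Bool) → Fin NO → ℕ
  degO S o = countF NI (λ i → S (combine o i))

  degI : (Fin NE → Bool) → Fin NI → ℕ
  degI S i = countF NO (λ o → S (combine o i))

  isPM : (Fin NO → Bool) → (Fin NI → Bool) → (Fin NE → Bool) → (Fin NE → Bool) → Bool
  isPM hO hI hE S =
    allF NE (λ e → S e ⇒ᵇ hE e) ∧
    (allF NO (λ o → hO o ⇒ᵇ (degO S o ≡ᵇ 1)) ∧
     allF NI (λ i → hI i ⇒ᵇ (degI S i ≡ᵇ 1)))

  connected : (Fin NE → Bool) → Bool
  connected S = allL (subsets n) λ X →
    (anyF n X ∧ not (allF n X)) ⇒ᵇ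
    anyF NE (λ e → S e ∧ (X (ownO (src e)) xor' X (ownI (tgt e))))
    where
      _xor'_ : Bool → Bool → Bool
      true  xor' b = not b
      false xor' b = b

-- Polynomials over a commutative ring in variables x_0 … x_{m-1},
-- as coefficient functions on exponent vectors.

module Poly {c ℓ} (F : CommutativeRing c ℓ) where
  open CommutativeRing F using (Carrier; _≈_; _+_; _*_; 0#; 1#)

  Pol : ℕ → Set c
  Pol m = (Fin m → ℕ) → Carrier

  _≈P_ : ∀ {m} → Pol m → Pol m → Set ℓ
  p ≈P q = ∀ α → p α ≈ q α

  0P : ∀ {m} → Pol m
  0P α = 0#

  1P : ∀ {m} → Pol m
  1P {m} α = if allF m (λ e → α e ≡ᵇ 0) then 1# else 0#

  var : ∀ {m} → Fin m → Pol m
  var {m} e α = if allF m (λ e' → α e' ≡ᵇ (if ⌊ e FinP.≟ e' ⌋ then 1 else 0)) then 1# else 0#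

  _+P_ : ∀ {m} → Pol m → Pol m → Pol m
  (p +P q) α = p α + q α

  sumFin : ∀ k → (Fin k → Carrier) → Carrier
  sumFin zero    f = 0#
  sumFin (suc k) f = f zero + sumFin k (f ∘ suc)

  _*P_ : ∀ {m} → Pol m → Pol m → Pol m
  _*P_ {zero}  p q α = p α * q α
  _*P_ {suc m} p q α =
    sumFin (suc (head α)) λ k →
      _*P_ {m} (λ β → p (toℕ k ∷ᶠ β)) (λ β → q ((head α ∸ toℕ k) ∷ᶠ β)) (tail α)

  ∑L : ∀ {a} {A : Set a} {m} → List A → (A → Pol m) → Pol m
  ∑L xs f = foldr (λ x acc → f x +P acc) 0P xs

  ∏F : ∀ {m} k → (Fin k → Pol m) → Pol m
  ∏F zero    f = 1P
  ∏F (suc k) f = f zero *P ∏F k (f ∘ suc)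

module Lemma6Polys {c ℓ} (F : CommutativeRing c ℓ)
                   (n : ℕ) (inD outD : Fin n → ℕ) where
  open BG n inD outD public
  open Poly F public

  mono : (Fin NE → Bool) → Pol NE
  mono S = ∏F NE (λ e → if S e then var e else 1P)

  module _ (BO : Fin NO → Bool) (BI : Fin NI → Bool) (BE : Fin NE → Bool) where

    Rpoly : Pol NE
    Rpoly = ∑L (subsets NE) λ S →
      if isPM BO BI BE S ∧ connected S then mono S else 0P

    PX : (Fin n → Bool) → Pol NE
    PX X = ∑L (subsets NE) λ S →
      if isPM (λ o → BO o ∧ X (ownO o))
              (λ i → BI i ∧ X (ownI i))
              (λ e → BE e ∧ (X (ownO (src e)) ∧ X (ownI (tgt e)))) S
      then mono S else 0P

    Ppoly : Fin n → Pol NE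
    Ppoly v* = ∑L (subsets n) λ X →
      if X v* then PX X *P PX (not ∘ X) else 0P

module Submission where

-- We compare coefficients at an exponent
-- vector α and write U = {e : α e = 1}.
--  * A sum of monomials ∏_{e∈S} x_e over a family of edge sets has coefficient 1 at α iff
--    α = 1_U and U belongs to the family (coeff-sum).
--  * Perfect matchings S of B[X] and R of B[V∖X] with 1_S + 1_R = α exist iff U is a perfect
--    matching of B with α = 1_U crossing no edge between X and V∖X, and then they are
--    U ∩ B[X] and U ∩ B[V∖X] (decomposition).  So [P]_α = [U perfect, α = 1_U] times the
--    number of X ∋ v* that U does not cross.
--  * In characteristic 2 that number is [U connected] (respecting-sets): for connected U only
--    X = V counts, otherwise X ↦ X ⊕ Y for a non-crossed Y ∌ v* pairs the sets off.
--  * A field with 2^t elements, t ≥ 1, has characteristic 2 (char-two): otherwise x ↦ -x is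
--    an involution with the single fixed point 0, so the order would be odd.

open import Defs
open import Algebra.Bundles using (CommutativeRing)
import Algebra.Properties.CommutativeMonoid.Sum as MonoidSum
import Algebra.Properties.CommutativeSemigroup as SemigroupProperties
import Algebra.Properties.Group as GroupProperties
open import Data.Bool.Base using (Bool; true; false; _∧_; _∨_; not; _xor_; if_then_else_; T)
import Data.Bool.Properties as BoolP
open import Data.Empty using (⊥-elim)
open import Data.Fin.Base using (Fin; zero; suc; toℕ; combine)
import Data.Fin.Properties as FinP
open import Data.Fin.Permutation using (permutation)
open import Data.List.Base using (List; []; _∷_; map; _++_; foldr)
import Data.List.Properties as ListP
open import Data.List.Membership.Propositional using (_∈_)
open import Data.List.Relation.Unary.Any using (here; there)
open import Data.Nat.Base using (ℕ; zero; suc; _≤_; _^_; _∸_; _≡ᵇ_; _<ᵇ_)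
import Data.Nat.Base as ℕ
import Data.Nat.Properties as ℕP
open import Data.Product.Base using (∃; _×_; _,_; proj₁; proj₂)
open import Data.Sum.Base using (inj₁; inj₂; [_,_]′)
open import Data.Unit.Base using (tt)
open import Data.Vec.Functional using (head; tail) renaming (_∷_ to _∷ᶠ_)
open import Function.Base using (_∘_; case_of_)
open import Function.Bundles using (Equivalence)
open import Relation.Nullary using (¬_; Dec; yes; no)
open import Relation.Nullary.Decidable using (⌊_⌋; toWitness; fromWitness)
open import Relation.Binary.Definitions using (tri<; tri≈; tri>)
open import Relation.Binary.PropositionalEquality as ≡
  using (_≡_; _≢_; refl; cong; cong₂; subst; module ≡-Reasoning)

T-true : ∀ {b} → T b → b ≡ true
T-true = Equivalence.to BoolP.T-≡

true-T : ∀ {b} → b ≡ true → T b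
true-T = Equivalence.from BoolP.T-≡

T-not : ∀ {b} → T (not b) → b ≡ false
T-not = Equivalence.to BoolP.T-not-≡

∧-intro : ∀ {a b} → T a → T b → T (a ∧ b)
∧-intro ha hb = Equivalence.from BoolP.T-∧ (ha , hb)

∧-elim : ∀ a {b} → T (a ∧ b) → T a × T b
∧-elim a = Equivalence.to (BoolP.T-∧ {a})

∧-keep : ∀ a {b} → (T a → T b) → (a ∧ b) ≡ a
∧-keep true  f = T-true (f tt)
∧-keep false f = refl

∧-swapʳ : ∀ a b c → ((a ∧ b) ∧ c) ≡ ((a ∧ c) ∧ b)
∧-swapʳ a b c = ≡.trans (BoolP.∧-assoc a b c) (≡.trans (cong (a ∧_) (BoolP.∧-comm b c)) (≡.sym (BoolP.∧-assoc a c b)))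

⇒ᵇ-elim : ∀ a {b} → T (a ⇒ᵇ b) → T a → T b
⇒ᵇ-elim true hb _ = hb

⇒ᵇ-intro : ∀ a {b} → (T a → T b) → T (a ⇒ᵇ b)
⇒ᵇ-intro true f = f tt
⇒ᵇ-intro false f = tt

⇒ᵇ-refute : ∀ a {b} → ¬ T (a ⇒ᵇ b) → T a × ¬ T b
⇒ᵇ-refute true h = tt , h
⇒ᵇ-refute false h = ⊥-elim (h tt)

¬T-false : ∀ {b} → ¬ T b → b ≡ false
¬T-false {true} h = ⊥-elim (h tt)
¬T-false {false} _ = refl

absent-if-true : ∀ {b x} → (T b → x ≡ false) → x ≡ true → b ≡ false
absent-if-true f refl = ¬T-false λ hb → case f hb of λ ()

absent-if-false : ∀ {b x} → (T b → x ≡ true) → x ≡ false → b ≡ false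
absent-if-false f refl = ¬T-false λ hb → case f hb of λ ()

T-ext : ∀ {a b} → (T a → T b) → (T b → T a) → a ≡ b
T-ext {true}  {true}  f g = refl
T-ext {true}  {false} f g = ⊥-elim (f tt)
T-ext {false} {true}  f g = ⊥-elim (g tt)
T-ext {false} {false} f g = refl

allF-elim : ∀ n (p : Fin n → Bool) → T (allF n p) → ∀ i → T (p i)
allF-elim (suc n) p h zero    = proj₁ (∧-elim (p zero) h)
allF-elim (suc n) p h (suc i) = allF-elim n (p ∘ suc) (proj₂ (∧-elim (p zero) h)) i

allF-intro : ∀ n (p : Fin n → Bool) → (∀ i → T (p i)) → T (allF n p)
allF-intro zero    p h = tt
allF-intro (suc n) p h = ∧-intro (h zero) (allF-intro n (p ∘ suc) (h ∘ suc))

allF-refute : ∀ n (p : Fin n → Bool) → ¬ T (allF n p) → ∃ λ i → ¬ T (p i)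
allF-refute zero    p h = ⊥-elim (h tt)
allF-refute (suc n) p h with p zero in eq
... | false = zero , λ hp → subst T eq hp
... | true  with i , hi ← allF-refute n (p ∘ suc) h = suc i , hi

anyF-elim : ∀ n (p : Fin n → Bool) → T (anyF n p) → ∃ λ i → T (p i)
anyF-elim (suc n) p h with p zero in eq
... | true  = zero , true-T eq
... | false with i , hi ← anyF-elim n (p ∘ suc) h = suc i , hi

anyF-intro : ∀ n (p : Fin n → Bool) i → T (p i) → T (anyF n p)
anyF-intro (suc n) p zero    h with p zero
... | true = tt
anyF-intro (suc n) p (suc i) h with p zero
... | true  = tt
... | false = anyF-intro n (p ∘ suc) i h

anyF-none : ∀ n (p : Fin n → Bool) → ¬ T (anyF n p) → ∀ i → ¬ T (p i)
anyF-none n p h i hi = h (anyF-intro n p i hi)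

allL-elim : ∀ {a} {A : Set a} (xs : List A) (p : A → Bool) {x} → T (allL xs p) → x ∈ xs → T (p x)
allL-elim (y ∷ xs) p h (here refl) = proj₁ (∧-elim (p y) h)
allL-elim (y ∷ xs) p h (there x∈) = allL-elim xs p (proj₂ (∧-elim (p y) h)) x∈

allL-refute : ∀ {a} {A : Set a} (xs : List A) (p : A → Bool) → ¬ T (allL xs p) → ∃ λ x → x ∈ xs × ¬ T (p x)
allL-refute []       p h = ⊥-elim (h tt)
allL-refute (y ∷ xs) p h with p y in eq
... | false = y , here refl , λ hp → subst T eq hp
... | true  with x , x∈ , hx ← allL-refute xs p h = x , there x∈ , hx

allF-cong : ∀ n {p q : Fin n → Bool} → (∀ i → p i ≡ q i) → allF n p ≡ allF n q
allF-cong zero    h = refl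
allF-cong (suc n) h = cong₂ _∧_ (h zero) (allF-cong n (h ∘ suc))

sumℕ-cong : ∀ n {f g : Fin n → ℕ} → (∀ i → f i ≡ g i) → sumℕ n f ≡ sumℕ n g
sumℕ-cong zero    h = refl
sumℕ-cong (suc n) h = cong₂ ℕ._+_ (h zero) (sumℕ-cong n (h ∘ suc))

sumℕ-zero : ∀ n {f : Fin n → ℕ} → (∀ i → f i ≡ 0) → sumℕ n f ≡ 0
sumℕ-zero zero    h = refl
sumℕ-zero (suc n) h = cong₂ ℕ._+_ (h zero) (sumℕ-zero n (h ∘ suc))

sumℕ-single : ∀ n (f : Fin n → ℕ) j → (∀ i → i ≢ j → f i ≡ 0) → sumℕ n f ≡ f j
sumℕ-single (suc n) f zero    h =
  ≡.trans (cong (f zero ℕ.+_) (sumℕ-zero n (λ i → h (suc i) λ ()))) (ℕP.+-identityʳ (f zero))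
sumℕ-single (suc n) f (suc j) h =
  cong₂ ℕ._+_ (h zero λ ()) (sumℕ-single n (f ∘ suc) j (λ i i≢j → h (suc i) (i≢j ∘ FinP.suc-injective)))

𝟙 : Bool → ℕ
𝟙 b = if b then 1 else 0

countF-cong : ∀ n {p q : Fin n → Bool} → (∀ i → p i ≡ q i) → countF n p ≡ countF n q
countF-cong n h = sumℕ-cong n (λ i → cong 𝟙 (h i))

-- the exponent vector of the monomial ∏_{e∈S} x_e
ind : ∀ {m} → (Fin m → Bool) → Fin m → ℕ
ind S e = 𝟙 (S e)

_≐_ : ∀ {k} → (Fin k → Bool) → (Fin k → Bool) → Bool
_≐_ {k} S A = allF k (λ i → ⌊ S i BoolP.≟ A i ⌋)

≐-sound : ∀ {k} {S A : Fin k → Bool} → T (S ≐ A) → ∀ i → S i ≡ A i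
≐-sound {k} {S} {A} h i = toWitness (allF-elim k _ h i)

≐-complete : ∀ {k} {S A : Fin k → Bool} → (∀ i → S i ≡ A i) → T (S ≐ A)
≐-complete {k} h = allF-intro k _ (λ i → fromWitness (h i))

ExtensionalB : ∀ m → ((Fin m → Bool) → Bool) → Set
ExtensionalB m Q = ∀ S S' → (∀ e → S e ≡ S' e) → Q S ≡ Q S'

_⊕_ : ∀ {k} → (Fin k → Bool) → (Fin k → Bool) → Fin k → Bool
(X ⊕ Y) i = X i xor Y i

_≐ᴺ_ : ∀ {m} → (Fin m → ℕ) → (Fin m → ℕ) → Bool
_≐ᴺ_ {m} α β = allF m (λ e → α e ≡ᵇ β e)

support : ∀ {m} → (Fin m → ℕ) → Fin m → Bool
support α e = α e ≡ᵇ 1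

≐ᴺ-sound : ∀ {m} {α β : Fin m → ℕ} → T (α ≐ᴺ β) → ∀ e → α e ≡ β e
≐ᴺ-sound {m} {α} {β} h e = ℕP.≡ᵇ⇒≡ (α e) (β e) (allF-elim m _ h e)

≐ᴺ-complete : ∀ {m} {α β : Fin m → ℕ} → (∀ e → α e ≡ β e) → T (α ≐ᴺ β)
≐ᴺ-complete {m} {α} {β} h = allF-intro m _ (λ e → ℕP.≡⇒≡ᵇ (α e) (β e) (h e))

support-ind : ∀ b → (𝟙 b ≡ᵇ 1) ≡ b
support-ind true  = refl
support-ind false = refl

≐ᴺ-ind : ∀ {m} α (S : Fin m → Bool) → T (α ≐ᴺ ind S) → ∀ e → S e ≡ support α e
≐ᴺ-ind α S h e = ≡.trans (≡.sym (support-ind (S e))) (cong (_≡ᵇ 1) (≡.sym (≐ᴺ-sound {α = α} {β = ind S} h e)))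

-- Counting modulo 2: an involution of Fin N with exactly one fixed point forces N odd,
-- since the remaining elements fall into pairs {i , σ i}.

module InvolutionParity (N : ℕ) (σ : Fin N → Fin N) (σ-involutive : ∀ i → σ (σ i) ≡ i)
                        (i₀ : Fin N) (fixed : ∀ i → σ i ≡ i → i ≡ i₀) (σi₀ : σ i₀ ≡ i₀) where
  open MonoidSum ℕP.+-0-commutativeMonoid using (sum; sum-permute; sum-cong-≗; ∑-distrib-+)

  below above point : Fin N → Bool
  below i = ⌊ i FinP.<? σ i ⌋
  above i = ⌊ σ i FinP.<? i ⌋
  point i = ⌊ i FinP.≟ i₀ ⌋

  trichotomy : ∀ i → 𝟙 (below i) ℕ.+ 𝟙 (above i) ℕ.+ 𝟙 (point i) ≡ 1
  trichotomy i with i FinP.<? σ i | σ i FinP.<? i | i FinP.≟ i₀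
  ... | yes lt | yes gt | _        = ⊥-elim (FinP.<-asym lt gt)
  ... | yes lt | no _   | yes refl = ⊥-elim (FinP.<-irrefl (≡.sym σi₀) lt)
  ... | yes _  | no _   | no _     = refl
  ... | no _   | yes gt | yes refl = ⊥-elim (FinP.<-irrefl σi₀ gt)
  ... | no _   | yes _  | no _     = refl
  ... | no _   | no _   | yes _    = refl
  ... | no lt  | no gt  | no ≢i₀ with FinP.<-cmp i (σ i)
  ...   | tri< l _ _ = ⊥-elim (lt l)
  ...   | tri≈ _ eq _ = ⊥-elim (≢i₀ (fixed i (≡.sym eq)))
  ...   | tri> _ _ g = ⊥-elim (gt g)

  sum-ones : ∀ n → sum {n} (λ _ → 1) ≡ n
  sum-ones zero    = refl
  sum-ones (suc n) = cong suc (sum-ones n)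

  sum-zeros : ∀ n → sum {n} (λ _ → 0) ≡ 0
  sum-zeros zero    = refl
  sum-zeros (suc n) = sum-zeros n

  sum-point : ∀ n (j : Fin n) → sum (λ i → 𝟙 (⌊ i FinP.≟ j ⌋)) ≡ 1
  sum-point (suc n) zero    = cong suc (sum-zeros n)
  sum-point (suc n) (suc j) = ≡.trans (sum-cong-≗ (λ i → cong 𝟙 (≟-suc i j))) (sum-point n j)
    where
    ≟-suc : ∀ i j → ⌊ suc i FinP.≟ suc j ⌋ ≡ ⌊ i FinP.≟ j ⌋
    ≟-suc i j with i FinP.≟ j
    ... | yes _ = refl
    ... | no _  = refl

  -- reindexing the sum along σ turns `below` into `above`
  sum-above : sum (λ i → 𝟙 (above i)) ≡ sum (λ i → 𝟙 (below i))
  sum-above = begin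
    sum (λ i → 𝟙 (above i))       ≡⟨ sum-cong-≗ (λ i → cong (λ j → 𝟙 (⌊ σ i FinP.<? j ⌋)) (≡.sym (σ-involutive i))) ⟩
    sum (λ i → 𝟙 (below (σ i)))   ≡⟨ ≡.sym (sum-permute (λ i → 𝟙 (below i)) (permutation σ σ σ-involutive σ-involutive)) ⟩
    sum (λ i → 𝟙 (below i))       ∎
    where open ≡-Reasoning

  -- N = Σ (below + above + point) = 2 · #below + 1
  odd : ∃ λ k → N ≡ suc (2 ℕ.* k)
  odd = k , (begin
    N                                                    ≡⟨ ≡.sym (sum-ones N) ⟩
    sum {N} (λ _ → 1)                                    ≡⟨ sum-cong-≗ (λ i → ≡.sym (trichotomy i)) ⟩
    sum (λ i → 𝟙 (below i) ℕ.+ 𝟙 (above i) ℕ.+ 𝟙 (point i))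
      ≡⟨ ≡.trans (∑-distrib-+ (λ i → 𝟙 (below i) ℕ.+ 𝟙 (above i)) _)
                 (cong₂ ℕ._+_ (∑-distrib-+ (λ i → 𝟙 (below i)) _) (sum-point N i₀)) ⟩
    k ℕ.+ sum (λ i → 𝟙 (above i)) ℕ.+ 1                  ≡⟨ cong (λ a → k ℕ.+ a ℕ.+ 1) sum-above ⟩
    k ℕ.+ k ℕ.+ 1                                        ≡⟨ ℕP.+-comm (k ℕ.+ k) 1 ⟩
    suc (k ℕ.+ k)                                        ≡⟨ cong (λ a → suc (k ℕ.+ a)) (≡.sym (ℕP.+-identityʳ k)) ⟩
    suc (2 ℕ.* k)                                        ∎)
    where
    open ≡-Reasoning
    k : ℕ
    k = sum (λ i → 𝟙 (below i))

module CharacteristicTwo {c ℓ} (F : CommutativeRing c ℓ) where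
  open CommutativeRing F renaming (refl to ≈-refl)
  open import Relation.Binary.Reasoning.Setoid setoid
  open GroupProperties +-group using (⁻¹-involutive; ε⁻¹≈ε)

  double : ∀ x → x + x ≈ (1# + 1#) * x
  double x = begin
    x + x             ≈⟨ +-cong (sym (*-identityˡ x)) (sym (*-identityˡ x)) ⟩
    1# * x + 1# * x   ≈⟨ sym (distribʳ x 1# 1#) ⟩
    (1# + 1#) * x     ∎

  double-zero : 1# + 1# ≈ 0# → ∀ x → x + x ≈ 0#
  double-zero two≈0 x = trans (double x) (trans (*-congʳ two≈0) (zeroˡ x))

  halve : ∀ y → (1# + 1#) * y ≈ 1# → ∀ x → x + x ≈ 0# → x ≈ 0#
  halve y 2y≈1 x x+x≈0 = begin
    x                     ≈⟨ sym (*-identityˡ x) ⟩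
    1# * x                ≈⟨ *-congʳ (sym 2y≈1) ⟩
    ((1# + 1#) * y) * x   ≈⟨ *-congʳ (*-comm _ y) ⟩
    (y * (1# + 1#)) * x   ≈⟨ *-assoc y _ x ⟩
    y * ((1# + 1#) * x)   ≈⟨ *-congˡ (trans (sym (double x)) x+x≈0) ⟩
    y * 0#                ≈⟨ zeroʳ y ⟩
    0#                    ∎

  module _ {N : ℕ} (card : HasCard F N) where
    private
      elem : Fin N → Carrier
      elem = proj₁ card
      elem-injective : ∀ i j → elem i ≈ elem j → i ≡ j
      elem-injective = proj₁ (proj₂ card)
      index : Carrier → Fin N
      index x = proj₁ (proj₂ (proj₂ card) x)
      elem-index : ∀ x → elem (index x) ≈ x
      elem-index x = proj₂ (proj₂ (proj₂ card) x)

    ≈-decidable : ∀ x y → Dec (x ≈ y)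
    ≈-decidable x y with index x FinP.≟ index y
    ... | yes eq = yes (trans (sym (elem-index x)) (trans (reflexive (cong elem eq)) (elem-index y)))
    ... | no ne  = no λ x≈y → ne (elem-injective _ _ (trans (elem-index x) (trans x≈y (sym (elem-index y)))))

    -- if 2 is invertible the order is odd: negation is an involution fixing only 0
    odd-order : ∀ y → (1# + 1#) * y ≈ 1# → ∃ λ k → N ≡ suc (2 ℕ.* k)
    odd-order y 2y≈1 = InvolutionParity.odd N σ σ-involutive (index 0#) fixed σ-fixes-0
      where
      σ : Fin N → Fin N
      σ i = index (- elem i)
      σ-involutive : ∀ i → σ (σ i) ≡ i
      σ-involutive i = elem-injective _ _ (trans (elem-index _)
        (trans (-‿cong (elem-index _)) (⁻¹-involutive (elem i))))
      fixed : ∀ i → σ i ≡ i → i ≡ index 0#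
      fixed i σi≡i = elem-injective _ _ (trans (halve y 2y≈1 (elem i) (begin
        elem i + elem i     ≈⟨ +-congˡ (trans (reflexive (cong elem (≡.sym σi≡i))) (elem-index _)) ⟩
        elem i + - elem i   ≈⟨ -‿inverseʳ (elem i) ⟩
        0#                  ∎)) (sym (elem-index 0#)))
      σ-fixes-0 : σ (index 0#) ≡ index 0#
      σ-fixes-0 = elem-injective _ _ (trans (elem-index _)
        (trans (-‿cong (elem-index 0#)) (trans ε⁻¹≈ε (sym (elem-index 0#)))))

  char-two : IsField F → ∀ t → 1 ≤ t → HasCard F (2 ^ t) → 1# + 1# ≈ 0#
  char-two isField (suc t) _ card with ≈-decidable card (1# + 1#) 0#
  ... | yes two≈0 = two≈0
  ... | no two≉0 with IsField.inverse isField _ two≉0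
  ...   | y , 2y≈1 with odd-order card y 2y≈1
  ...     | k , 2^t≡odd = ⊥-elim (ℕP.even≢odd (2 ^ t) k 2^t≡odd)

module CubeSums {c ℓ} (F : CommutativeRing c ℓ) where
  open CommutativeRing F hiding (zero) renaming (refl to ≈-refl)
  open import Relation.Binary.Reasoning.Setoid setoid
  open SemigroupProperties +-commutativeSemigroup using (interchange)
  open CharacteristicTwo F using (double-zero)

  ⟦_⟧ : Bool → Carrier
  ⟦ b ⟧ = if b then 1# else 0#

  sumL : ∀ {a} {A : Set a} → List A → (A → Carrier) → Carrier
  sumL xs g = foldr (λ x acc → g x + acc) 0# xs

  sumL-cong∈ : ∀ {a} {A : Set a} (xs : List A) {f g : A → Carrier} →
               (∀ x → x ∈ xs → f x ≈ g x) → sumL xs f ≈ sumL xs g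
  sumL-cong∈ []       h = ≈-refl
  sumL-cong∈ (x ∷ xs) h = +-cong (h x (here refl)) (sumL-cong∈ xs (λ y y∈ → h y (there y∈)))

  sumL-cong : ∀ {a} {A : Set a} (xs : List A) {f g : A → Carrier} →
              (∀ x → f x ≈ g x) → sumL xs f ≈ sumL xs g
  sumL-cong xs h = sumL-cong∈ xs (λ x _ → h x)

  sumL-+ : ∀ {a} {A : Set a} (xs : List A) (f g : A → Carrier) →
           sumL xs (λ x → f x + g x) ≈ sumL xs f + sumL xs g
  sumL-+ []       f g = sym (+-identityʳ 0#)
  sumL-+ (x ∷ xs) f g = trans (+-congˡ (sumL-+ xs f g)) (interchange _ _ _ _)

  sumL-zero : ∀ {a} {A : Set a} (xs : List A) {f : A → Carrier} → (∀ x → f x ≈ 0#) → sumL xs f ≈ 0#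
  sumL-zero []       h = ≈-refl
  sumL-zero (x ∷ xs) h = trans (+-cong (h x) (sumL-zero xs h)) (+-identityʳ 0#)

  sumL-if : ∀ {a} {A : Set a} (xs : List A) b (f : A → Carrier) →
            sumL xs (λ x → if b then f x else 0#) ≈ (if b then sumL xs f else 0#)
  sumL-if xs true  f = ≈-refl
  sumL-if xs false f = sumL-zero xs (λ _ → ≈-refl)

  sumL-++ : ∀ {a} {A : Set a} (xs ys : List A) (f : A → Carrier) →
            sumL (xs ++ ys) f ≈ sumL xs f + sumL ys f
  sumL-++ []       ys f = sym (+-identityˡ _)
  sumL-++ (x ∷ xs) ys f = trans (+-congˡ (sumL-++ xs ys f)) (sym (+-assoc _ _ _))

  sumL-map : ∀ {a b} {A : Set a} {B : Set b} (h : A → B) (xs : List A) (f : B → Carrier) →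
             sumL (map h xs) f ≡ sumL xs (f ∘ h)
  sumL-map h xs f = ListP.foldr-map _ h 0# xs

  cube-split : ∀ k (f : (Fin (suc k) → Bool) → Carrier) →
    sumL (subsets (suc k)) f ≈ sumL (subsets k) (f ∘ (false ∷ᶠ_)) + sumL (subsets k) (f ∘ (true ∷ᶠ_))
  cube-split k f = trans (sumL-++ (map (false ∷ᶠ_) (subsets k)) _ f)
    (+-cong (reflexive (sumL-map _ (subsets k) f)) (reflexive (sumL-map _ (subsets k) f)))

  cube-point : ∀ k (A : Fin k → Bool) c → sumL (subsets k) (λ S → if S ≐ A then c else 0#) ≈ c
  cube-point zero    A c = +-identityʳ c
  cube-point (suc k) A c = trans (cube-split k _) (halves (A zero))
    where
    half : Bool → Bool → (Fin k → Bool) → Carrier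
    half b a S = if ⌊ b BoolP.≟ a ⌋ ∧ (S ≐ (A ∘ suc)) then c else 0#
    halves : ∀ a → sumL (subsets k) (half false a) + sumL (subsets k) (half true a) ≈ c
    halves false = trans (+-congʳ (cube-point k (A ∘ suc) c))
                         (trans (+-congˡ (sumL-zero (subsets k) (λ _ → ≈-refl))) (+-identityʳ c))
    halves true  = trans (+-congʳ (sumL-zero (subsets k) (λ _ → ≈-refl)))
                         (trans (+-identityˡ _) (cube-point k (A ∘ suc) c))

  Extensional : ∀ k → ((Fin k → Bool) → Carrier) → Set _
  Extensional k g = ∀ X X' → (∀ i → X i ≡ X' i) → g X ≈ g X'

  cube-translate : ∀ k (g : (Fin k → Bool) → Carrier) → Extensional k g → (Y : Fin k → Bool) →
                   sumL (subsets k) g ≈ sumL (subsets k) (λ X → g (X ⊕ Y))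
  cube-translate zero    g ext Y = +-congʳ (ext _ _ (λ ()))
  cube-translate (suc k) g ext Y =
    trans (cube-split k g) (trans (halves (Y zero) refl) (sym (cube-split k _)))
    where
    on : Bool → (Fin k → Bool) → Carrier
    on b S = g (b ∷ᶠ S)
    on-ext : ∀ b → Extensional k (on b)
    on-ext b X X' h = ext _ _ λ { zero → refl ; (suc i) → h i }
    -- translating the tail by Y ∘ suc, then fixing the head coordinate
    moved : ∀ b b' → b' ≡ b xor Y zero →
            sumL (subsets k) (on b') ≈ sumL (subsets k) (λ S → g ((b ∷ᶠ S) ⊕ Y))
    moved b b' eq = trans (cube-translate k (on b') (on-ext b') (Y ∘ suc))
      (sumL-cong (subsets k) λ S → ext _ _ λ { zero → eq ; (suc i) → refl })
    halves : ∀ y → Y zero ≡ y →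
      sumL (subsets k) (on false) + sumL (subsets k) (on true) ≈
      sumL (subsets k) (λ S → g ((false ∷ᶠ S) ⊕ Y)) + sumL (subsets k) (λ S → g ((true ∷ᶠ S) ⊕ Y))
    halves false eq = +-cong (moved false false (≡.sym eq)) (moved true true (cong not (≡.sym eq)))
    halves true  eq = trans (+-comm _ _)
      (+-cong (moved false true (≡.sym eq)) (moved true false (cong not (≡.sym eq))))

  -- In characteristic 2, a function invariant under translation by a nonzero Y sums
  -- to zero: split by the coordinate j with Y j = true and pair X with X ⊕ Y.
  cube-parity : 1# + 1# ≈ 0# → ∀ k (g : (Fin k → Bool) → Carrier) → Extensional k g →
    (Y : Fin k → Bool) (j : Fin k) → Y j ≡ true → (∀ X → g (X ⊕ Y) ≈ g X) →
    sumL (subsets k) g ≈ 0#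
  cube-parity two≈0 k g ext Y j Yj≡true invariant = begin
    sumL cube g                                             ≈⟨ sumL-cong cube split ⟩
    sumL cube (λ X → on X + off X)                          ≈⟨ sumL-+ cube on off ⟩
    sumL cube on + sumL cube off                            ≈⟨ +-congʳ (cube-translate k on on-ext Y) ⟩
    sumL cube (λ X → on (X ⊕ Y)) + sumL cube off            ≈⟨ +-congʳ (sumL-cong cube swap) ⟩
    sumL cube off + sumL cube off                           ≈⟨ double-zero two≈0 _ ⟩
    0#                                                      ∎
    where
    cube : List (Fin k → Bool)
    cube = subsets k
    on off : (Fin k → Bool) → Carrier
    on  X = if X j then g X else 0#
    off X = if X j then 0# else g X
    split : ∀ X → g X ≈ on X + off X
    split X with X j
    ... | true  = sym (+-identityʳ _)
    ... | false = sym (+-identityˡ _)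
    on-ext : Extensional k on
    on-ext X X' h rewrite h j with X' j
    ... | true  = ext X X' h
    ... | false = ≈-refl
    swap : ∀ X → on (X ⊕ Y) ≈ off X
    swap X rewrite Yj≡true with X j
    ... | true  = ≈-refl
    ... | false = invariant X

module Coefficients {c ℓ} (F : CommutativeRing c ℓ) where
  open CommutativeRing F hiding (zero) renaming (refl to ≈-refl)
  open import Relation.Binary.Reasoning.Setoid setoid
  open Poly F
  open CubeSums F

  sumFin-cong : ∀ k {f g : Fin k → Carrier} → (∀ i → f i ≈ g i) → sumFin k f ≈ sumFin k g
  sumFin-cong zero    h = ≈-refl
  sumFin-cong (suc k) h = +-cong (h zero) (sumFin-cong k (h ∘ suc))

  sumFin-+ : ∀ k (f g : Fin k → Carrier) → sumFin k (λ i → f i + g i) ≈ sumFin k f + sumFin k g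
  sumFin-+ zero    f g = sym (+-identityʳ 0#)
  sumFin-+ (suc k) f g = trans (+-congˡ (sumFin-+ k (f ∘ suc) (g ∘ suc)))
    (SemigroupProperties.interchange +-commutativeSemigroup _ _ _ _)

  sumFin-zero : ∀ k {f : Fin k → Carrier} → (∀ i → f i ≈ 0#) → sumFin k f ≈ 0#
  sumFin-zero zero    h = ≈-refl
  sumFin-zero (suc k) h = trans (+-cong (h zero) (sumFin-zero k (h ∘ suc))) (+-identityʳ 0#)

  slice : ∀ {m} → Pol (suc m) → ℕ → Pol m
  slice p x β = p (x ∷ᶠ β)

  *P-cong : ∀ {m} {p p' q q' : Pol m} → p ≈P p' → q ≈P q' → (p *P q) ≈P (p' *P q')
  *P-cong {zero}  hp hq α = *-cong (hp α) (hq α)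
  *P-cong {suc m} hp hq α = sumFin-cong (suc (head α)) λ k →
    *P-cong {m} (hp ∘ (toℕ k ∷ᶠ_)) (hq ∘ ((head α ∸ toℕ k) ∷ᶠ_)) (tail α)

  *P-distribʳ : ∀ {m} (p q r : Pol m) → ((p +P q) *P r) ≈P ((p *P r) +P (q *P r))
  *P-distribʳ {zero}  p q r α = distribʳ (r α) (p α) (q α)
  *P-distribʳ {suc m} p q r α = trans
    (sumFin-cong (suc (head α)) λ k → *P-distribʳ (slice p (toℕ k)) (slice q (toℕ k)) (slice r (head α ∸ toℕ k)) (tail α))
    (sumFin-+ (suc (head α)) (term p) (term q))
    where
    term : Pol (suc m) → Fin (suc (head α)) → Carrier
    term s k = (slice s (toℕ k) *P slice r (head α ∸ toℕ k)) (tail α)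

  *P-distribˡ : ∀ {m} (p q r : Pol m) → (p *P (q +P r)) ≈P ((p *P q) +P (p *P r))
  *P-distribˡ {zero}  p q r α = distribˡ (p α) (q α) (r α)
  *P-distribˡ {suc m} p q r α = trans
    (sumFin-cong (suc (head α)) λ k → *P-distribˡ (slice p (toℕ k)) (slice q (head α ∸ toℕ k)) (slice r (head α ∸ toℕ k)) (tail α))
    (sumFin-+ (suc (head α)) (term q) (term r))
    where
    term : Pol (suc m) → Fin (suc (head α)) → Carrier
    term s k = (slice p (toℕ k) *P slice s (head α ∸ toℕ k)) (tail α)

  *P-zeroˡ : ∀ {m} (q : Pol m) → (0P *P q) ≈P 0P
  *P-zeroˡ {zero}  q α = zeroˡ (q α)
  *P-zeroˡ {suc m} q α = sumFin-zero (suc (head α)) λ k → *P-zeroˡ (slice q (head α ∸ toℕ k)) (tail α)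

  *P-zeroʳ : ∀ {m} (p : Pol m) → (p *P 0P) ≈P 0P
  *P-zeroʳ {zero}  p α = zeroʳ (p α)
  *P-zeroʳ {suc m} p α = sumFin-zero (suc (head α)) λ k → *P-zeroʳ (slice p (toℕ k)) (tail α)

  ∑L-cong : ∀ {a} {A : Set a} {m} (xs : List A) {f g : A → Pol m} → (∀ x → f x ≈P g x) → ∑L xs f ≈P ∑L xs g
  ∑L-cong []       h α = ≈-refl
  ∑L-cong (x ∷ xs) h α = +-cong (h x α) (∑L-cong xs h α)

  ∑L-at : ∀ {a} {A : Set a} {m} (xs : List A) (f : A → Pol m) α → ∑L xs f α ≡ sumL xs (λ x → f x α)
  ∑L-at []       f α = refl
  ∑L-at (x ∷ xs) f α = cong (f x α +_) (∑L-at xs f α)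

  ∑L-*P : ∀ {a} {A : Set a} {m} (xs : List A) (f : A → Pol m) q → (∑L xs f *P q) ≈P ∑L xs (λ x → f x *P q)
  ∑L-*P []       f q = *P-zeroˡ q
  ∑L-*P (x ∷ xs) f q α = trans (*P-distribʳ (f x) (∑L xs f) q α) (+-congˡ (∑L-*P xs f q α))

  *P-∑L : ∀ {a} {A : Set a} {m} (xs : List A) (f : A → Pol m) p → (p *P ∑L xs f) ≈P ∑L xs (λ x → p *P f x)
  *P-∑L []       f p = *P-zeroʳ p
  *P-∑L (x ∷ xs) f p α = trans (*P-distribˡ p (f x) (∑L xs f) α) (+-congˡ (*P-∑L xs f p α))

  guarded-at : ∀ {m} b (p : Pol m) α → (if b then p else 0P) α ≡ (if b then p α else 0#)
  guarded-at {m} b p α = BoolP.if-float (λ (q : Pol m) → q α) b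

  guarded-*P : ∀ {m} b₁ b₂ (p q : Pol m) →
               ((if b₁ then p else 0P) *P (if b₂ then q else 0P)) ≈P (if b₁ ∧ b₂ then p *P q else 0P)
  guarded-*P true  true  p q α = ≈-refl
  guarded-*P true  false p q   = *P-zeroʳ p
  guarded-*P false b₂    p q   = *P-zeroˡ _

  infix 30 x^_
  x^_ : ∀ {m} → (Fin m → ℕ) → Pol m
  (x^ β) α = ⟦ α ≐ᴺ β ⟧

  x^-cong : ∀ {m} {β γ : Fin m → ℕ} → (∀ e → β e ≡ γ e) → (x^ β) ≈P (x^ γ)
  x^-cong {m} h α = reflexive (cong ⟦_⟧ (allF-cong m (λ e → cong (α e ≡ᵇ_) (h e))))

  x^-slice : ∀ {m} (β : Fin (suc m) → ℕ) x → slice (x^ β) x ≈P (if x ≡ᵇ head β then x^ (tail β) else 0P)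
  x^-slice β x γ with x ≡ᵇ head β
  ... | true  = ≈-refl
  ... | false = ≈-refl

  sumFin-pick : ∀ N b (h : ℕ → Carrier) →
    sumFin N (λ k → if toℕ k ≡ᵇ b then h (toℕ k) else 0#) ≈ (if b <ᵇ N then h b else 0#)
  sumFin-pick zero    b       h = ≈-refl
  sumFin-pick (suc N) zero    h = trans (+-congˡ (sumFin-zero N (λ _ → ≈-refl))) (+-identityʳ (h 0))
  sumFin-pick (suc N) (suc b) h = trans (+-identityˡ _) (sumFin-pick N b (h ∘ suc))

  ≤-∸-≡ᵇ : ∀ a b g → ((b <ᵇ suc a) ∧ ((a ∸ b) ≡ᵇ g)) ≡ (a ≡ᵇ (b ℕ.+ g))
  ≤-∸-≡ᵇ a       zero    g = refl
  ≤-∸-≡ᵇ zero    (suc b) g = refl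
  ≤-∸-≡ᵇ (suc a) (suc b) g = ≤-∸-≡ᵇ a b g

  x^-*P : ∀ {m} (β γ : Fin m → ℕ) → (x^ β *P x^ γ) ≈P x^ (λ e → β e ℕ.+ γ e)
  x^-*P {zero}  β γ α = *-identityʳ 1#
  x^-*P {suc m} β γ α = begin
    sumFin (suc a) (λ k → (slice (x^ β) (toℕ k) *P slice (x^ γ) (a ∸ toℕ k)) (tail α))
      ≈⟨ sumFin-cong (suc a) (λ k → term (toℕ k)) ⟩
    sumFin (suc a) (λ k → if toℕ k ≡ᵇ head β then h (toℕ k) else 0#)
      ≈⟨ sumFin-pick (suc a) (head β) h ⟩
    (if head β <ᵇ suc a then h (head β) else 0#)
      ≡⟨ ≡.sym (BoolP.if-∧ (head β <ᵇ suc a)) ⟩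
    (if (head β <ᵇ suc a) ∧ ((a ∸ head β) ≡ᵇ head γ) then C else 0#)
      ≡⟨ cong (λ b → if b then C else 0#) (≤-∸-≡ᵇ a (head β) (head γ)) ⟩
    (if a ≡ᵇ (head β ℕ.+ head γ) then C else 0#)
      ≡⟨ ≡.sym (BoolP.if-∧ (a ≡ᵇ (head β ℕ.+ head γ))) ⟩
    (x^ (λ e → β e ℕ.+ γ e)) α ∎
    where
    a : ℕ
    a = head α
    C : Carrier
    C = (x^ (λ e → tail β e ℕ.+ tail γ e)) (tail α)
    h : ℕ → Carrier
    h x = if (a ∸ x) ≡ᵇ head γ then C else 0#
    term : ∀ x → (slice (x^ β) x *P slice (x^ γ) (a ∸ x)) (tail α) ≈ (if x ≡ᵇ head β then h x else 0#)
    term x = begin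
      (slice (x^ β) x *P slice (x^ γ) (a ∸ x)) (tail α)
        ≈⟨ *P-cong (x^-slice β x) (x^-slice γ (a ∸ x)) (tail α) ⟩
      ((if x ≡ᵇ head β then x^ tail β else 0P) *P (if (a ∸ x) ≡ᵇ head γ then x^ tail γ else 0P)) (tail α)
        ≈⟨ guarded-*P (x ≡ᵇ head β) _ (x^ tail β) (x^ tail γ) (tail α) ⟩
      (if (x ≡ᵇ head β) ∧ ((a ∸ x) ≡ᵇ head γ) then x^ tail β *P x^ tail γ else 0P) (tail α)
        ≈⟨ read-guard ⟩
      (if x ≡ᵇ head β then h x else 0#) ∎
      where
      read-guard : (if (x ≡ᵇ head β) ∧ ((a ∸ x) ≡ᵇ head γ) then x^ tail β *P x^ tail γ else 0P) (tail α)
                  ≈ (if x ≡ᵇ head β then h x else 0#)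
      read-guard with x ≡ᵇ head β | (a ∸ x) ≡ᵇ head γ
      ... | true  | true  = x^-*P (tail β) (tail γ) (tail α)
      ... | true  | false = ≈-refl
      ... | false | _     = ≈-refl

  ∏F-cong : ∀ {m} k {f g : Fin k → Pol m} → (∀ i → f i ≈P g i) → ∏F k f ≈P ∏F k g
  ∏F-cong zero    h α = ≈-refl
  ∏F-cong (suc k) h = *P-cong (h zero) (∏F-cong k (h ∘ suc))

  ∏F-x^ : ∀ {m} k (βs : Fin k → Fin m → ℕ) → ∏F k (λ i → x^ βs i) ≈P x^ (λ e → sumℕ k (λ i → βs i e))
  ∏F-x^ zero    βs α = ≈-refl
  ∏F-x^ (suc k) βs α = trans (*P-cong (λ _ → ≈-refl) (∏F-x^ k (βs ∘ suc)) α) (x^-*P (βs zero) _ α)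

  monomial : ∀ {m} → (Fin m → Bool) → Pol m
  monomial {m} S = ∏F m (λ e → if S e then var e else 1P)

  monomial-x^ : ∀ {m} (S : Fin m → Bool) → monomial S ≈P x^ ind S
  monomial-x^ {m} S α = trans (∏F-cong m factor α)
    (trans (∏F-x^ m exponent α) (x^-cong (λ e → ≡.trans (sumℕ-single m _ e (off-diagonal e)) (diagonal e)) α))
    where
    unit : Fin m → Fin m → ℕ
    unit e e' = 𝟙 ⌊ e FinP.≟ e' ⌋
    exponent : Fin m → Fin m → ℕ
    exponent e = if S e then unit e else (λ _ → 0)
    factor : ∀ e → (if S e then var e else 1P) ≈P x^ exponent e
    factor e with S e
    ... | true  = λ _ → ≈-refl
    ... | false = λ _ → ≈-refl
    off-diagonal : ∀ e' e → e ≢ e' → exponent e e' ≡ 0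
    off-diagonal e' e e≢e' with S e
    ... | false = refl
    ... | true with e FinP.≟ e'
    ...   | yes e≡e' = ⊥-elim (e≢e' e≡e')
    ...   | no _     = refl
    diagonal : ∀ e → exponent e e ≡ ind S e
    diagonal e with S e
    ... | false = refl
    ... | true with e FinP.≟ e
    ...   | yes _   = refl
    ...   | no e≢e  = ⊥-elim (e≢e refl)

  -- only the support of α can contribute to the coefficient at α of a sum of monomials
  single-contributor : ∀ {m} (Q : (Fin m → Bool) → Bool) → ExtensionalB m Q → ∀ α S →
    (Q S ∧ α ≐ᴺ ind S) ≡ ((S ≐ support α) ∧ (Q (support α) ∧ α ≐ᴺ ind (support α)))
  single-contributor {m} Q ext α S = T-ext forward backward
    where
    ind-cong : (∀ e → S e ≡ support α e) → (α ≐ᴺ ind S) ≡ (α ≐ᴺ ind (support α))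
    ind-cong h = allF-cong m (λ e → cong (λ b → α e ≡ᵇ 𝟙 b) (h e))
    forward : T (Q S ∧ α ≐ᴺ ind S) → T ((S ≐ support α) ∧ (Q (support α) ∧ α ≐ᴺ ind (support α)))
    forward h with hQ , hα ← ∧-elim (Q S) h =
      ∧-intro (≐-complete S≡supp) (∧-intro (subst T (ext _ _ S≡supp) hQ) (subst T (ind-cong S≡supp) hα))
      where
      S≡supp : ∀ e → S e ≡ support α e
      S≡supp = ≐ᴺ-ind α S hα
    backward : T ((S ≐ support α) ∧ (Q (support α) ∧ α ≐ᴺ ind (support α))) → T (Q S ∧ α ≐ᴺ ind S)
    backward h with hS , rest ← ∧-elim (S ≐ support α) h with hQ , hα ← ∧-elim (Q (support α)) rest =
      ∧-intro (subst T (≡.sym (ext _ _ (≐-sound hS))) hQ) (subst T (≡.sym (ind-cong (≐-sound hS))) hα)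

  guarded-monomial : ∀ {m} b (S : Fin m → Bool) → (if b then monomial S else 0P) ≈P (if b then x^ ind S else 0P)
  guarded-monomial true  S = monomial-x^ S
  guarded-monomial false S α = ≈-refl

  coeff-sum : ∀ {m} (Q : (Fin m → Bool) → Bool) → ExtensionalB m Q → ∀ α →
    ∑L (subsets m) (λ S → if Q S then monomial S else 0P) α ≈ ⟦ Q (support α) ∧ α ≐ᴺ ind (support α) ⟧
  coeff-sum {m} Q ext α = begin
    ∑L (subsets m) (λ S → if Q S then monomial S else 0P) α
      ≡⟨ ∑L-at (subsets m) _ α ⟩
    sumL (subsets m) (λ S → (if Q S then monomial S else 0P) α)
      ≈⟨ sumL-cong (subsets m) (λ S → guarded-monomial (Q S) S α) ⟩
    sumL (subsets m) (λ S → (if Q S then x^ ind S else 0P) α)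
      ≈⟨ sumL-cong (subsets m) (λ S → reflexive (≡.trans (guarded-at (Q S) _ α) (≡.sym (BoolP.if-∧ (Q S))))) ⟩
    sumL (subsets m) (λ S → ⟦ Q S ∧ α ≐ᴺ ind S ⟧)
      ≈⟨ sumL-cong (subsets m) (λ S → reflexive (≡.trans (cong ⟦_⟧ (single-contributor Q ext α S)) (BoolP.if-∧ (S ≐ support α)))) ⟩
    sumL (subsets m) (λ S → if S ≐ support α then ⟦ Q (support α) ∧ α ≐ᴺ ind (support α) ⟧ else 0#)
      ≈⟨ cube-point m (support α) _ ⟩
    ⟦ Q (support α) ∧ α ≐ᴺ ind (support α) ⟧ ∎

  coeff-product : ∀ {m} (Q₁ Q₂ : (Fin m → Bool) → Bool) α →
    (∑L (subsets m) (λ S → if Q₁ S then monomial S else 0P) *P ∑L (subsets m) (λ R → if Q₂ R then monomial R else 0P)) α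
    ≈ sumL (subsets m) (λ S → sumL (subsets m) (λ R → ⟦ (Q₁ S ∧ Q₂ R) ∧ α ≐ᴺ (λ e → ind S e ℕ.+ ind R e) ⟧))
  coeff-product {m} Q₁ Q₂ α = begin
    (∑L cube (λ S → term Q₁ S) *P ∑L cube (λ R → term Q₂ R)) α
      ≈⟨ ∑L-*P cube (term Q₁) _ α ⟩
    ∑L cube (λ S → term Q₁ S *P ∑L cube (term Q₂)) α
      ≈⟨ ∑L-cong cube (λ S → *P-∑L cube (term Q₂) (term Q₁ S)) α ⟩
    ∑L cube (λ S → ∑L cube (λ R → term Q₁ S *P term Q₂ R)) α
      ≡⟨ ∑L-at cube _ α ⟩
    sumL cube (λ S → ∑L cube (λ R → term Q₁ S *P term Q₂ R) α)
      ≈⟨ sumL-cong cube (λ S → reflexive (∑L-at cube _ α)) ⟩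
    sumL cube (λ S → sumL cube (λ R → (term Q₁ S *P term Q₂ R) α))
      ≈⟨ sumL-cong cube (λ S → sumL-cong cube (λ R → pair S R)) ⟩
    sumL cube (λ S → sumL cube (λ R → ⟦ (Q₁ S ∧ Q₂ R) ∧ α ≐ᴺ (λ e → ind S e ℕ.+ ind R e) ⟧)) ∎
    where
    cube : List (Fin m → Bool)
    cube = subsets m
    term : ((Fin m → Bool) → Bool) → (Fin m → Bool) → Pol m
    term Q S = if Q S then monomial S else 0P
    pair : ∀ S R → (term Q₁ S *P term Q₂ R) α ≈ ⟦ (Q₁ S ∧ Q₂ R) ∧ α ≐ᴺ (λ e → ind S e ℕ.+ ind R e) ⟧
    pair S R = begin
      (term Q₁ S *P term Q₂ R) α
        ≈⟨ *P-cong (guarded-monomial (Q₁ S) S) (guarded-monomial (Q₂ R) R) α ⟩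
      ((if Q₁ S then x^ ind S else 0P) *P (if Q₂ R then x^ ind R else 0P)) α
        ≈⟨ guarded-*P (Q₁ S) (Q₂ R) _ _ α ⟩
      (if Q₁ S ∧ Q₂ R then x^ ind S *P x^ ind R else 0P) α
        ≡⟨ guarded-at (Q₁ S ∧ Q₂ R) _ α ⟩
      (if Q₁ S ∧ Q₂ R then (x^ ind S *P x^ ind R) α else 0#)
        ≈⟨ product-guard (Q₁ S ∧ Q₂ R) ⟩
      ⟦ (Q₁ S ∧ Q₂ R) ∧ α ≐ᴺ (λ e → ind S e ℕ.+ ind R e) ⟧ ∎
      where
      product-guard : ∀ b → (if b then (x^ ind S *P x^ ind R) α else 0#) ≈ ⟦ b ∧ α ≐ᴺ (λ e → ind S e ℕ.+ ind R e) ⟧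
      product-guard true  = x^-*P (ind S) (ind R) α
      product-guard false = ≈-refl

module Matchings (n : ℕ) (inD outD : Fin n → ℕ) where
  open BG n inD outD

  origin target : Fin NE → Fin n
  origin e = ownO (src e)
  target e = ownI (tgt e)

  origin-combine : ∀ o i → origin (combine o i) ≡ ownO o
  origin-combine o i = cong (ownO ∘ proj₁) (FinP.remQuot-combine {NO} {NI} o i)

  target-combine : ∀ o i → target (combine o i) ≡ ownI i
  target-combine o i = cong (ownI ∘ proj₂) (FinP.remQuot-combine {NO} {NI} o i)

  record Perfect (hO : Fin NO → Bool) (hI : Fin NI → Bool) (hE S : Fin NE → Bool) : Set where
    field
      ⊆edges : ∀ e → T (S e) → T (hE e)
      degO≡1 : ∀ o → T (hO o) → degO S o ≡ 1
      degI≡1 : ∀ i → T (hI i) → degI S i ≡ 1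
  open Perfect

  isPM-sound : ∀ hO hI hE S → T (isPM hO hI hE S) → Perfect hO hI hE S
  isPM-sound hO hI hE S h with h₁ , h₂₃ ← ∧-elim (allF NE _) h with h₂ , h₃ ← ∧-elim (allF NO _) h₂₃ = record
    { ⊆edges = λ e → ⇒ᵇ-elim (S e) (allF-elim NE _ h₁ e)
    ; degO≡1 = λ o ho → ℕP.≡ᵇ⇒≡ _ 1 (⇒ᵇ-elim (hO o) (allF-elim NO _ h₂ o) ho)
    ; degI≡1 = λ i hi → ℕP.≡ᵇ⇒≡ _ 1 (⇒ᵇ-elim (hI i) (allF-elim NI _ h₃ i) hi)
    }

  isPM-complete : ∀ hO hI hE S → Perfect hO hI hE S → T (isPM hO hI hE S)
  isPM-complete hO hI hE S p =
    ∧-intro (allF-intro NE _ λ e → ⇒ᵇ-intro (S e) (⊆edges p e))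
      (∧-intro (allF-intro NO _ λ o → ⇒ᵇ-intro (hO o) λ ho → ℕP.≡⇒≡ᵇ _ 1 (degO≡1 p o ho))
               (allF-intro NI _ λ i → ⇒ᵇ-intro (hI i) λ hi → ℕP.≡⇒≡ᵇ _ 1 (degI≡1 p i hi)))

  isPM-ext : ∀ hO hI hE {S S'} → (∀ e → S e ≡ S' e) → isPM hO hI hE S ≡ isPM hO hI hE S'
  isPM-ext hO hI hE h = cong₂ _∧_ (allF-cong NE (λ e → cong (_⇒ᵇ hE e) (h e)))
    (cong₂ _∧_ (allF-cong NO (λ o → cong (λ d → hO o ⇒ᵇ (d ℕ.≡ᵇ 1)) (countF-cong NI (λ i → h (combine o i)))))
               (allF-cong NI (λ i → cong (λ d → hI i ⇒ᵇ (d ℕ.≡ᵇ 1)) (countF-cong NO (λ o → h (combine o i))))))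

  Respects : (Fin NE → Bool) → (Fin n → Bool) → Set
  Respects U X = ∀ e → T (U e) → X (origin e) ≡ X (target e)

  respects : (Fin NE → Bool) → (Fin n → Bool) → Bool
  respects U X = allF NE (λ e → U e ⇒ᵇ ⌊ X (origin e) BoolP.≟ X (target e) ⌋)

  respects-sound : ∀ U X → T (respects U X) → Respects U X
  respects-sound U X h e ue = toWitness (⇒ᵇ-elim (U e) (allF-elim NE _ h e) ue)

  respects-complete : ∀ U X → Respects U X → T (respects U X)
  respects-complete U X r = allF-intro NE _ λ e → ⇒ᵇ-intro (U e) λ ue → fromWitness (r e ue)

  _↾_ : (Fin NE → Bool) → (Fin n → Bool) → Fin NE → Bool
  (U ↾ Z) e = U e ∧ (Z (origin e) ∧ Z (target e))

  _∪_ : (Fin NE → Bool) → (Fin NE → Bool) → Fin NE → Bool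
  (S ∪ R) e = S e ∨ R e

  ind-split : ∀ {U} X → Respects U X → ∀ e → ind U e ≡ ind (U ↾ X) e ℕ.+ ind (U ↾ (not ∘ X)) e
  ind-split {U} X resp e with U e in u
  ... | false = refl
  ... | true with X (origin e) | X (target e) | resp e (true-T u)
  ...   | true  | true  | _  = refl
  ...   | false | false | _  = refl
  ...   | true  | false | ()
  ...   | false | true  | ()

  module _ (BO : Fin NO → Bool) (BI : Fin NI → Bool) (BE : Fin NE → Bool) where

    PerfectIn : (Fin n → Bool) → (Fin NE → Bool) → Set
    PerfectIn Z = Perfect (λ o → BO o ∧ Z (ownO o)) (λ i → BI i ∧ Z (ownI i)) (BE ↾ Z)

    isPMIn : (Fin n → Bool) → (Fin NE → Bool) → Bool
    isPMIn Z = isPM (λ o → BO o ∧ Z (ownO o)) (λ i → BI i ∧ Z (ownI i)) (BE ↾ Z)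

    -- A perfect matching of B not crossing Z restricts to one of B[Z]: at a vertex
    -- in Z every matching edge stays inside Z, so the degree is unchanged.
    restrict-perfect : ∀ {U} Z {S} → Perfect BO BI BE U → Respects U Z → (∀ e → S e ≡ (U ↾ Z) e) → PerfectIn Z S
    restrict-perfect {U} Z {S} pU resp S≡ = record
      { ⊆edges = λ e se → let ue , zz = ∧-elim (U e) (subst T (S≡ e) se) in ∧-intro (⊆edges pU e ue) zz
      ; degO≡1 = λ o h → let bo , zo = ∧-elim (BO o) h in
          ≡.trans (countF-cong NI λ i → keep (combine o i) λ _ → ≡.trans (cong Z (origin-combine o i)) (T-true zo))
                  (degO≡1 pU o bo)
      ; degI≡1 = λ i h → let bi , zi = ∧-elim (BI i) h in
          ≡.trans (countF-cong NO λ o → keep (combine o i) λ ue →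
                     ≡.trans (resp _ ue) (≡.trans (cong Z (target-combine o i)) (T-true zi)))
                  (degI≡1 pU i bi)
      }
      where
      -- an edge of U with an end in Z lies inside Z, so restricting keeps it
      keep : ∀ e → (T (U e) → Z (origin e) ≡ true) → S e ≡ U e
      keep e z = ≡.trans (S≡ e) (∧-keep (U e) λ ue →
        ∧-intro (true-T (z ue)) (true-T (≡.trans (≡.sym (resp e ue)) (z ue))))

    module Glue {X : Fin n → Bool} {S R U : Fin NE → Bool} (pS : PerfectIn X S) (pR : PerfectIn (not ∘ X) R)
                (U≡S∪R : ∀ e → U e ≡ (S ∪ R) e) where

      S-inside : ∀ e → T (S e) → X (origin e) ≡ true × X (target e) ≡ true
      S-inside e se with _ , xx ← ∧-elim (BE e) (⊆edges pS e se) with xs , xt ← ∧-elim (X (origin e)) xx =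
        T-true xs , T-true xt

      R-inside : ∀ e → T (R e) → X (origin e) ≡ false × X (target e) ≡ false
      R-inside e re with _ , xx ← ∧-elim (BE e) (⊆edges pR e re) with xs , xt ← ∧-elim (not (X (origin e))) xx =
        T-not xs , T-not xt

      U-cases : ∀ {a} {A : Set a} e → T (U e) → (T (S e) → A) → (T (R e) → A) → A
      U-cases e ue onS onR = [ onS , onR ]′ (Equivalence.to BoolP.T-∨ (subst T (U≡S∪R e) ue))

      U≡S : ∀ e → R e ≡ false → U e ≡ S e
      U≡S e r = ≡.trans (U≡S∪R e) (≡.trans (cong (S e ∨_) r) (BoolP.∨-identityʳ (S e)))

      U≡R : ∀ e → S e ≡ false → U e ≡ R e
      U≡R e s = ≡.trans (U≡S∪R e) (cong (_∨ R e) s)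

      -- at a vertex in X the matching U agrees with S, at a vertex outside X with R
      perfect : Perfect BO BI BE U
      perfect = record
        { ⊆edges = λ e ue → U-cases e ue (λ se → proj₁ (∧-elim (BE e) (⊆edges pS e se)))
                                         (λ re → proj₁ (∧-elim (BE e) (⊆edges pR e re)))
        ; degO≡1 = λ o bo → degO-at o bo (X (ownO o)) refl
        ; degI≡1 = λ i bi → degI-at i bi (X (ownI i)) refl
        }
        where
        degO-at : ∀ o → T (BO o) → ∀ x → X (ownO o) ≡ x → degO U o ≡ 1
        degO-at o bo true  x = ≡.trans
          (countF-cong NI λ i → U≡S _ (absent-if-true (proj₁ ∘ R-inside _) (≡.trans (cong X (origin-combine o i)) x)))
          (degO≡1 pS o (∧-intro bo (true-T x)))
        degO-at o bo false x = ≡.trans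
          (countF-cong NI λ i → U≡R _ (absent-if-false (proj₁ ∘ S-inside _) (≡.trans (cong X (origin-combine o i)) x)))
          (degO≡1 pR o (∧-intro bo (true-T (cong not x))))
        degI-at : ∀ i → T (BI i) → ∀ x → X (ownI i) ≡ x → degI U i ≡ 1
        degI-at i bi true  x = ≡.trans
          (countF-cong NO λ o → U≡S _ (absent-if-true (proj₂ ∘ R-inside _) (≡.trans (cong X (target-combine o i)) x)))
          (degI≡1 pS i (∧-intro bi (true-T x)))
        degI-at i bi false x = ≡.trans
          (countF-cong NO λ o → U≡R _ (absent-if-false (proj₂ ∘ S-inside _) (≡.trans (cong X (target-combine o i)) x)))
          (degI≡1 pR i (∧-intro bi (true-T (cong not x))))

      respects-X : Respects U X
      respects-X e ue = U-cases e ue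
        (λ se → let xs , xt = S-inside e se in ≡.trans xs (≡.sym xt))
        (λ re → let xs , xt = R-inside e re in ≡.trans xs (≡.sym xt))

      restrict-S : ∀ e → S e ≡ (U ↾ X) e
      restrict-S e = T-ext
        (λ se → let xs , xt = S-inside e se in
          ∧-intro (subst T (≡.sym (U≡S∪R e)) (Equivalence.from BoolP.T-∨ (inj₁ se))) (∧-intro (true-T xs) (true-T xt)))
        (λ h → let ue , xx = ∧-elim (U e) h in
          U-cases e ue (λ se → se)
            (λ re → ⊥-elim (subst T (absent-if-true (proj₁ ∘ R-inside e) (T-true (proj₁ (∧-elim (X (origin e)) xx)))) re)))

      restrict-R : ∀ e → R e ≡ (U ↾ (not ∘ X)) e
      restrict-R e = T-ext
        (λ re → let xs , xt = R-inside e re in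
          ∧-intro (subst T (≡.sym (U≡S∪R e)) (Equivalence.from BoolP.T-∨ (inj₂ re))) (∧-intro (true-T (cong not xs)) (true-T (cong not xt))))
        (λ h → let ue , xx = ∧-elim (U e) h in
          U-cases e ue
            (λ se → ⊥-elim (subst T (absent-if-false (proj₁ ∘ S-inside e) (T-not (proj₁ (∧-elim (not (X (origin e))) xx)))) se))
            (λ re → re))

      -- S and R are disjoint, so their exponent vectors add up to that of U
      ind-union : ∀ e → ind S e ℕ.+ ind R e ≡ ind U e
      ind-union e with S e in s | R e in r
      ... | true  | true  = ⊥-elim (subst T (absent-if-true (proj₁ ∘ R-inside e) (proj₁ (S-inside e (true-T s)))) (true-T r))
      ... | true  | false = cong 𝟙 (≡.sym (≡.trans (U≡S e r) s))
      ... | false | _     = cong 𝟙 (≡.sym (≡.trans (U≡R e s) r))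

    -- The pairs (S, R) contributing to the coefficient of P_X · P_{V∖X} at α: such a pair
    -- exists iff U = support α is a perfect matching of B not crossing X with α = 1_U,
    -- and then it is unique, S = U ↾ X and R = U ↾ (V∖X).
    decomposition : ∀ (α : Fin NE → ℕ) X S R →
      ((isPMIn X S ∧ isPMIn (not ∘ X) R) ∧ α ≐ᴺ (λ e → ind S e ℕ.+ ind R e))
      ≡ ((S ≐ (support α ↾ X)) ∧ ((R ≐ (support α ↾ (not ∘ X)))
          ∧ ((isPM BO BI BE (support α) ∧ α ≐ᴺ ind (support α)) ∧ respects (support α) X)))
    decomposition α X S R = T-ext forward backward
      where
      U : Fin NE → Bool
      U = support α
      forward : T ((isPMIn X S ∧ isPMIn (not ∘ X) R) ∧ α ≐ᴺ (λ e → ind S e ℕ.+ ind R e)) →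
                T ((S ≐ (U ↾ X)) ∧ ((R ≐ (U ↾ (not ∘ X))) ∧ ((isPM BO BI BE U ∧ α ≐ᴺ ind U) ∧ respects U X)))
      forward h with hSR , hα ← ∧-elim (isPMIn X S ∧ isPMIn (not ∘ X) R) h
                 with hS , hR ← ∧-elim (isPMIn X S) hSR =
        ∧-intro (≐-complete restrict-S) (∧-intro (≐-complete restrict-R)
          (∧-intro (∧-intro (isPM-complete _ _ _ U perfect) (≐ᴺ-complete α≡1U)) (respects-complete U X respects-X)))
        where
        pS : PerfectIn X S
        pS = isPM-sound _ _ _ S hS
        pR : PerfectIn (not ∘ X) R
        pR = isPM-sound _ _ _ R hR
        α≡ : ∀ e → α e ≡ ind S e ℕ.+ ind R e
        α≡ = ≐ᴺ-sound {α = α} hα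
        module S∪R = Glue {X = X} pS pR (λ e → refl)
        U≡S∪R : ∀ e → U e ≡ (S ∪ R) e
        U≡S∪R e = ≡.trans (cong (ℕ._≡ᵇ 1) (≡.trans (α≡ e) (S∪R.ind-union e))) (support-ind ((S ∪ R) e))
        open Glue {X = X} pS pR U≡S∪R
        α≡1U : ∀ e → α e ≡ ind U e
        α≡1U e = ≡.trans (α≡ e) (ind-union e)
      backward : T ((S ≐ (U ↾ X)) ∧ ((R ≐ (U ↾ (not ∘ X))) ∧ ((isPM BO BI BE U ∧ α ≐ᴺ ind U) ∧ respects U X))) →
                 T ((isPMIn X S ∧ isPMIn (not ∘ X) R) ∧ α ≐ᴺ (λ e → ind S e ℕ.+ ind R e))
      backward h with hS , h' ← ∧-elim (S ≐ (U ↾ X)) h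
                 with hR , h'' ← ∧-elim (R ≐ (U ↾ (not ∘ X))) h'
                 with hUα , hresp ← ∧-elim (isPM BO BI BE U ∧ α ≐ᴺ ind U) h''
                 with hU , hα ← ∧-elim (isPM BO BI BE U) hUα =
        ∧-intro (∧-intro (isPM-complete _ _ _ S (restrict-perfect X pU resp (≐-sound hS)))
                         (isPM-complete _ _ _ R (restrict-perfect (not ∘ X) pU (λ e ue → cong not (resp e ue)) (≐-sound hR))))
                (≐ᴺ-complete α≡)
        where
        pU : Perfect BO BI BE U
        pU = isPM-sound _ _ _ U hU
        resp : Respects U X
        resp = respects-sound U X hresp
        α≡ : ∀ e → α e ≡ ind S e ℕ.+ ind R e
        α≡ e = ≡.trans (≐ᴺ-sound {α = α} hα e) (≡.trans (ind-split X resp e)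
                 (cong₂ ℕ._+_ (cong 𝟙 (≡.sym (≐-sound hS e)))
                              (cong 𝟙 (≡.sym (≐-sound hR e)))))

  crossing-edge : ∀ U X → T (connected U) → X ∈ subsets n → T (anyF n X ∧ not (allF n X)) →
                  ∃ λ e → T (U e) × X (origin e) ≢ X (target e)
  crossing-edge U X conn X∈ proper
    with e , h ← anyF-elim NE _ (⇒ᵇ-elim _ (allL-elim (subsets n) _ conn X∈) proper)
    with ue , differ ← ∧-elim (U e) h
    with X (origin e) in xs | X (target e) in xt
  ... | true  | false = e , ue , λ eq → case ≡.trans (≡.sym xs) (≡.trans eq xt) of λ ()
  ... | false | true  = e , ue , λ eq → case ≡.trans (≡.sym xs) (≡.trans eq xt) of λ ()
  ... | true  | true  = ⊥-elim differ
  ... | false | false = ⊥-elim differ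

  proper-respected : ∀ U → ¬ T (connected U) →
                     ∃ λ Y → Y ∈ subsets n × T (anyF n Y) × ¬ T (allF n Y) × Respects U Y
  proper-respected U disconn
    with Y , Y∈ , h ← allL-refute (subsets n) _ disconn
    with proper , no-edge ← ⇒ᵇ-refute (anyF n Y ∧ not (allF n Y)) h
    with nonempty , not-all ← ∧-elim (anyF n Y) proper =
    Y , Y∈ , nonempty , (λ all → subst T (cong not (T-true all)) not-all) , respects-Y
    where
    respects-Y : Respects U Y
    respects-Y e ue with Y (origin e) | Y (target e) | anyF-none NE _ no-edge e
    ... | true  | true  | _     = refl
    ... | false | false | _     = refl
    ... | true  | false | cross = ⊥-elim (cross (∧-intro ue tt))
    ... | false | true  | cross = ⊥-elim (cross (∧-intro ue tt))

  -- ... and, replacing Y by its complement if necessary, one avoiding a given vertex v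
  separating-set : ∀ U (v : Fin n) → ¬ T (connected U) →
                   ∃ λ Y → Y v ≡ false × (∃ λ j → Y j ≡ true) × Respects U Y
  separating-set U v disconn with Y , _ , nonempty , not-all , resp ← proper-respected U disconn | Y v in Yv
  ... | false = Y , Yv , (let j , Yj = anyF-elim n Y nonempty in j , T-true Yj) , resp
  ... | true  = not ∘ Y , cong not Yv , (let j , Yj = allF-refute n Y not-all in j , cong not (¬T-false Yj))
              , λ e ue → cong not (resp e ue)

  connected-respects : ∀ U X (v : Fin n) → T (connected U) → X ∈ subsets n → T (X v) → T (respects U X) →
                       ∀ i → X i ≡ true
  connected-respects U X v conn X∈ Xv resp with allF n X in all
  ... | true  = T-true ∘ allF-elim n X (true-T all)
  ... | false with e , ue , differ ← crossing-edge U X conn X∈ (∧-intro (anyF-intro n X v Xv) (true-T (cong not all)))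
    = ⊥-elim (differ (respects-sound U X resp e ue))

  respects-ext : ∀ U {X X'} → (∀ i → X i ≡ X' i) → respects U X ≡ respects U X'
  respects-ext U h = allF-cong NE λ e → cong (λ b → U e ⇒ᵇ b) (cong₂ (λ a b → ⌊ a BoolP.≟ b ⌋) (h (origin e)) (h (target e)))

  respects-translate : ∀ U X Y → Respects U Y → respects U (X ⊕ Y) ≡ respects U X
  respects-translate U X Y resp = allF-cong NE pointwise
    where
    xor-≟ : ∀ a b y → ⌊ (a xor y) BoolP.≟ (b xor y) ⌋ ≡ ⌊ a BoolP.≟ b ⌋
    xor-≟ true  true  true  = refl
    xor-≟ true  true  false = refl
    xor-≟ true  false true  = refl
    xor-≟ true  false false = refl
    xor-≟ false true  true  = refl
    xor-≟ false true  false = refl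
    xor-≟ false false true  = refl
    xor-≟ false false false = refl
    pointwise : ∀ e → (U e ⇒ᵇ ⌊ (X ⊕ Y) (origin e) BoolP.≟ (X ⊕ Y) (target e) ⌋) ≡ (U e ⇒ᵇ ⌊ X (origin e) BoolP.≟ X (target e) ⌋)
    pointwise e with U e in u
    ... | false = refl
    ... | true rewrite resp e (true-T u) = xor-≟ (X (origin e)) (X (target e)) (Y (target e))

  -- connectivity depends only on the edge set: a set respected by one of two equal
  -- edge sets is respected by the other
  connected-ext : ExtensionalB NE connected
  connected-ext S S' S≡S' = T-ext (transfer S S' S≡S') (transfer S' S (≡.sym ∘ S≡S'))
    where
    transfer : ∀ S S' → (∀ e → S e ≡ S' e) → T (connected S) → T (connected S')
    transfer S S' S≡S' conn with connected S' in conn'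
    ... | true  = tt
    ... | false with Y , Y∈ , nonempty , not-all , resp ← proper-respected S' (subst T conn')
                with e , se , crosses ← crossing-edge S Y conn Y∈ (∧-intro nonempty (true-T (cong not (¬T-false not-all))))
      = crosses (resp e (subst T (S≡S' e) se))

module Lemma6Coefficients {c ℓ} (F : CommutativeRing c ℓ) (n : ℕ) (inD outD : Fin n → ℕ) where
  open CommutativeRing F hiding (zero) renaming (refl to ≈-refl)
  open import Relation.Binary.Reasoning.Setoid setoid
  open Lemma6Polys F n inD outD
  open Matchings n inD outD
  open CubeSums F
  open Coefficients F

  module _ (two≈0 : 1# + 1# ≈ 0#) where

    -- In characteristic 2, the number of sets X ∋ v respected by U is ≡ [U connected]:
    -- for connected U only X = V counts, otherwise translating by a respected
    -- nonempty Y ∌ v pairs the sets off.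
    respecting-sets : ∀ U v → sumL (subsets n) (λ X → ⟦ X v ∧ respects U X ⟧) ≈ ⟦ connected U ⟧
    respecting-sets U v with connected U in conn
    ... | true = trans (sumL-cong∈ (subsets n) λ X X∈ → reflexive (cong ⟦_⟧ (only-V X X∈))) (cube-point n (λ _ → true) 1#)
      where
      only-V : ∀ X → X ∈ subsets n → (X v ∧ respects U X) ≡ (X ≐ (λ _ → true))
      only-V X X∈ = T-ext
        (λ h → let Xv , resp = ∧-elim (X v) h in ≐-complete (connected-respects U X v (true-T conn) X∈ Xv resp))
        (λ h → let all = ≐-sound h in
           ∧-intro (true-T (all v)) (respects-complete U X λ e _ → ≡.trans (all (origin e)) (≡.sym (all (target e)))))
    ... | false with Y , Yv , (j , Yj) , resp ← separating-set U v (λ h → subst T conn h) =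
      cube-parity two≈0 n f f-ext Y j Yj invariant
      where
      f : (Fin n → Bool) → Carrier
      f X = ⟦ X v ∧ respects U X ⟧
      f-ext : Extensional n f
      f-ext X X' h = reflexive (cong ⟦_⟧ (cong₂ _∧_ (h v) (respects-ext U h)))
      invariant : ∀ X → f (X ⊕ Y) ≈ f X
      invariant X = reflexive (cong ⟦_⟧ (cong₂ _∧_
        (≡.trans (cong (X v xor_) Yv) (BoolP.xor-identityʳ (X v))) (respects-translate U X Y resp)))

  module _ (BO : Fin NO → Bool) (BI : Fin NI → Bool) (BE : Fin NE → Bool) (α : Fin NE → ℕ) where
    private
      U : Fin NE → Bool
      U = support α
      matching : Bool
      matching = isPM BO BI BE U ∧ α ≐ᴺ ind U

    product-coeff : ∀ X → (PX BO BI BE X *P PX BO BI BE (not ∘ X)) α ≈ ⟦ matching ∧ respects U X ⟧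
    product-coeff X = begin
      (PX BO BI BE X *P PX BO BI BE (not ∘ X)) α
        ≈⟨ coeff-product (isPMIn BO BI BE X) (isPMIn BO BI BE (not ∘ X)) α ⟩
      sumL cube (λ S → sumL cube (λ R → ⟦ (isPMIn BO BI BE X S ∧ isPMIn BO BI BE (not ∘ X) R) ∧ α ≐ᴺ (λ e → ind S e ℕ.+ ind R e) ⟧))
        ≈⟨ sumL-cong cube (λ S → sumL-cong cube (λ R → reflexive (split S R))) ⟩
      sumL cube (λ S → sumL cube (λ R → if S ≐ (U ↾ X) then (if R ≐ (U ↾ (not ∘ X)) then ⟦ matching ∧ respects U X ⟧ else 0#) else 0#))
        ≈⟨ sumL-cong cube (λ S → sumL-if cube (S ≐ (U ↾ X)) _) ⟩
      sumL cube (λ S → if S ≐ (U ↾ X) then sumL cube (λ R → if R ≐ (U ↾ (not ∘ X)) then ⟦ matching ∧ respects U X ⟧ else 0#) else 0#)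
        ≈⟨ cube-point NE (U ↾ X) _ ⟩
      sumL cube (λ R → if R ≐ (U ↾ (not ∘ X)) then ⟦ matching ∧ respects U X ⟧ else 0#)
        ≈⟨ cube-point NE (U ↾ (not ∘ X)) _ ⟩
      ⟦ matching ∧ respects U X ⟧ ∎
      where
      cube : List (Fin NE → Bool)
      cube = subsets NE
      split : ∀ S R → ⟦ (isPMIn BO BI BE X S ∧ isPMIn BO BI BE (not ∘ X) R) ∧ α ≐ᴺ (λ e → ind S e ℕ.+ ind R e) ⟧
                    ≡ (if S ≐ (U ↾ X) then (if R ≐ (U ↾ (not ∘ X)) then ⟦ matching ∧ respects U X ⟧ else 0#) else 0#)
      split S R = ≡.trans (cong ⟦_⟧ (decomposition BO BI BE α X S R))
                  (≡.trans (BoolP.if-∧ (S ≐ (U ↾ X))) (cong (λ r → if S ≐ (U ↾ X) then r else 0#) (BoolP.if-∧ (R ≐ (U ↾ (not ∘ X))))))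

    R-coeff : Rpoly BO BI BE α ≈ ⟦ (isPM BO BI BE U ∧ connected U) ∧ α ≐ᴺ ind U ⟧
    R-coeff = coeff-sum (λ S → isPM BO BI BE S ∧ connected S)
      (λ S S' h → cong₂ _∧_ (isPM-ext BO BI BE h) (connected-ext S S' h)) α

    P-coeff : 1# + 1# ≈ 0# → ∀ v → Ppoly BO BI BE v α ≈ ⟦ matching ∧ connected U ⟧
    P-coeff two≈0 v = begin
      Ppoly BO BI BE v α
        ≡⟨ ∑L-at (subsets n) _ α ⟩
      sumL (subsets n) (λ X → (if X v then PX BO BI BE X *P PX BO BI BE (not ∘ X) else 0P) α)
        ≈⟨ sumL-cong (subsets n) (λ X → term X) ⟩
      sumL (subsets n) (λ X → if matching then ⟦ X v ∧ respects U X ⟧ else 0#)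
        ≈⟨ sumL-if (subsets n) matching _ ⟩
      (if matching then sumL (subsets n) (λ X → ⟦ X v ∧ respects U X ⟧) else 0#)
        ≈⟨ count matching ⟩
      ⟦ matching ∧ connected U ⟧ ∎
      where
      term : ∀ X → (if X v then PX BO BI BE X *P PX BO BI BE (not ∘ X) else 0P) α ≈ (if matching then ⟦ X v ∧ respects U X ⟧ else 0#)
      term X with X v
      ... | true  = trans (product-coeff X) (reflexive (BoolP.if-∧ matching))
      ... | false = reflexive (≡.sym (BoolP.if-eta matching))
      count : ∀ b → (if b then sumL (subsets n) (λ X → ⟦ X v ∧ respects U X ⟧) else 0#) ≈ ⟦ b ∧ connected U ⟧
      count true  = respecting-sets two≈0 U v
      count false = ≈-refl

-- P and R have the same coefficient at every α.
lemma6 : ∀ {c ℓ} (F : CommutativeRing c ℓ) → IsField F →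
    (t : ℕ) → 1 ≤ t → HasCard F (2 ^ t) →
    (n : ℕ) (E : Fin n → Fin n → Bool) (inD outD : Fin n → ℕ) →
    let open Lemma6Polys F n inD outD in
    (BO : Fin NO → Bool) (BI : Fin NI → Bool) (BE : Fin NE → Bool) →
    (∀ e → BE e ≡ true →
      (BO (src e) ≡ true × BI (tgt e) ≡ true) × E (ownO (src e)) (ownI (tgt e)) ≡ true) →
    (v* : Fin n) →
    Ppoly BO BI BE v* ≈P Rpoly BO BI BE
lemma6 F isField t 1≤t card n _ inD outD BO BI BE _ v* α = begin
  Ppoly BO BI BE v* α                                          ≈⟨ P-coeff BO BI BE α two≈0 v* ⟩
  ⟦ (isPM BO BI BE U ∧ α ≐ᴺ ind U) ∧ connected U ⟧           ≡⟨ cong ⟦_⟧ (∧-swapʳ (isPM BO BI BE U) _ _) ⟩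
  ⟦ (isPM BO BI BE U ∧ connected U) ∧ α ≐ᴺ ind U ⟧           ≈⟨ R-coeff BO BI BE α ⟨
  Rpoly BO BI BE α                                             ∎
  where
  open CommutativeRing F
  open import Relation.Binary.Reasoning.Setoid setoid
  open Lemma6Polys F n inD outD using (NE; isPM; connected; Ppoly; Rpoly)
  open Lemma6Coefficients F n inD outD
  open CubeSums F using (⟦_⟧)
  open CharacteristicTwo F using (char-two)
  U : Fin NE → Bool
  U = support α
  two≈0 : 1# + 1# ≈ 0#
  two≈0 = char-two isField t 1≤t card
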